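{- Let $q\ge3$, $p=1$, and set $a=\lceil q/2\rceil$. Put $E=1$, $A=(1-a)\tau+a-q$, $F=q-a$, $B=1-\tau$, $G=(a-1)\tau+1$. Then $A\tau+B=E\tau^4+F\tau^2+G$, and $A,B,E,F,G$ all belong to the minimal norm digit set modulo $\tau^2$, so both sides are valid digit expansions; in particular the $2$-NAF is not a minimal (optimal) digit expansion.
   Context: $\tau=\frac p2+i\sqrt{q-\frac14}$ is a root of $X^2-pX+q$ and $\mathbb{Z}[\tau]=\{x+y\tau:x,y\in\mathbb{Z}\}$. The minimal norm digit set modulo $\tau^w$ is the set consisting of $0$ together with, for each residue class of $\mathbb{Z}[\tau]$ modulo $\tau^w$ not divisible by $\tau$, its (unique) representative of minimal absolute value. Digit expansions, the $w$-NAF (in every block of $w$ consecutive digits at most one is nonzero), weight (number of nonzero digits) and optimality (minimal weight among all expansions of the same element with digits in the digit set) are as usual; the $w$-NAF is minimal if the $w$-NAF of every element of $\mathbb{Z}[\tau]$ is optimal. -}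

module Defs where

open import Data.Nat as ℕ using (ℕ; zero; suc)
open import Data.Integer as ℤ using (ℤ; +_; _+_; _*_; -_; _-_; _<_; _≤_)
open import Data.List using (List; []; _∷_; length; filter)
open import Data.List.Relation.Unary.All using (All)
open import Data.Product using (Σ; _×_; ∃)
open import Data.Sum using (_⊎_)
open import Relation.Binary.PropositionalEquality using (_≡_)
open import Relation.Nullary using (¬_)

-- Elements x + y τ of ℤ[τ], τ a root of X² - pX + q with 4q > p² (τ non-real),
-- so {1, τ} is a ℤ-basis and equality of elements is equality of coordinates.
record ℤ[τ] : Set where
  constructor mk
  field
    re : ℤ
    im : ℤ
open ℤ[τ] public

module Arith (p q : ℤ) where

  0τ 1τ τ : ℤ[τ]
  0τ = mk (+ 0) (+ 0)
  1τ = mk (+ 1) (+ 0)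
  τ  = mk (+ 0) (+ 1)

  infixl 6 _⊕_ _⊖_
  infixl 7 _⊗_
  infixr 8 _^τ_

  _⊕_ : ℤ[τ] → ℤ[τ] → ℤ[τ]
  (mk a b) ⊕ (mk c d) = mk (a + c) (b + d)

  _⊖_ : ℤ[τ] → ℤ[τ] → ℤ[τ]
  (mk a b) ⊖ (mk c d) = mk (a - c) (b - d)

  -- (a + bτ)(c + dτ) = ac + (ad + bc)τ + bd τ²,  τ² = pτ - q
  _⊗_ : ℤ[τ] → ℤ[τ] → ℤ[τ]
  (mk a b) ⊗ (mk c d) = mk (a * c - q * (b * d)) (a * d + b * c + p * (b * d))

  _^τ_ : ℤ[τ] → ℕ → ℤ[τ]
  z ^τ zero    = 1τ
  z ^τ (suc n) = z ⊗ (z ^τ n)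

  ∣_∣² : ℤ[τ] → ℤ
  ∣ mk x y ∣² = x * x + p * (x * y) + q * (y * y)

  _∣τ_ : ℤ[τ] → ℤ[τ] → Set
  m ∣τ z = Σ ℤ[τ] λ k → z ≡ m ⊗ k

  _≡_mod-τ^_ : ℤ[τ] → ℤ[τ] → ℕ → Set
  z ≡ z' mod-τ^ w = (τ ^τ w) ∣τ (z ⊖ z')

  MinNormDigit : ℕ → ℤ[τ] → Set
  MinNormDigit w d =
    d ≡ 0τ ⊎
    ( ¬ (τ ∣τ d)
    × (∀ z → z ≡ d mod-τ^ w → ¬ (z ≡ d) → ∣ d ∣² < ∣ z ∣²) )

  -- A digit expansion: list of digits d₀ ∷ d₁ ∷ …, least significant first,
  -- with value Σ dⱼ τ^j.
  value : List ℤ[τ] → ℤ[τ]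
  value []       = 0τ
  value (d ∷ ds) = d ⊕ τ ⊗ value ds

  ValidExpansion : ℕ → List ℤ[τ] → Set
  ValidExpansion w ds = All (MinNormDigit w) ds

  weight : List ℤ[τ] → ℕ
  weight []       = 0
  weight (d ∷ ds) with re d ℤ.≟ + 0 | im d ℤ.≟ + 0
  ... | Relation.Nullary.yes _ | Relation.Nullary.yes _ = weight ds
  ... | _ | _ = suc (weight ds)

  -- w-NAF: in every block of w consecutive digits at most one is nonzero,
  -- i.e. every nonzero digit is followed by at least w-1 zero digits.
  zeros : ℕ → List ℤ[τ] → Set
  zeros zero    ds       = Data.Unit.⊤
    where import Data.Unit
  zeros (suc n) []       = Data.Unit.⊤
    where import Data.Unit
  zeros (suc n) (d ∷ ds) = d ≡ 0τ × zeros n ds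

  IsNAF : ℕ → List ℤ[τ] → Set
  IsNAF w []       = Data.Unit.⊤
    where import Data.Unit
  IsNAF w (d ∷ ds) = (d ≡ 0τ ⊎ zeros (w ℕ.∸ 1) ds) × IsNAF w ds

  Optimal : ℕ → List ℤ[τ] → Set
  Optimal w ds = ∀ es → ValidExpansion w es → value es ≡ value ds → weight ds ℕ.≤ weight es

  NAFMinimal : ℕ → Set
  NAFMinimal w = ∀ ds → ValidExpansion w ds → IsNAF w ds → Optimal w ds

{-# OPTIONS --safe #-}
-- Writing k = u + vτ,
-- ∣d + τ²k∣² - ∣d∣² = q²∣k∣² + α u + β v, with α, β twice the inner products
-- of d with τ² and τ³, so a digit d with τ ∤ d has minimal norm in its class
-- modulo τ² iff this quadratic function of k is positive for k ≠ 0. As for a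
-- Voronoi cell it suffices to check the six vectors ±1, ±τ, ±(τ - 1): every k
-- lies in a cone spanned by two consecutive ones, on which the function is a
-- nonnegative combination of its two values plus a nonnegative remainder.
-- Writing q = 3 + r + 2t with r ∈ {0, 1}, so that a = 2 + t, all these
-- inequalities for the five digits are polynomials in t with nonnegative
-- coefficients, which a computation on Horner normal forms confirms. The
-- expansion identity is ring arithmetic, and as F = q - a ≠ 0 the 2-NAF
-- G 0 F 0 E has weight 3 while B A has weight at most 2.
module Submission where

open import Defs
open import Data.Nat using (ℕ; _≤_; _/_)
open import Data.Integer using (ℤ; +_; _-_)
open import Data.List using (List; []; _∷_)
open import Data.Product using (_×_)
open import Relation.Binary.PropositionalEquality using (_≡_)
open import Relation.Nullary using (¬_)

import Data.Nat as ℕ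
import Data.Nat.Properties as ℕP
import Data.Integer as ℤ
import Data.Integer.Properties as ℤP
open import Algebra.Bundles.Raw using (RawRing)
open import Level using (_⊔_)
open import Relation.Unary using (Decidable)
open import Relation.Nullary using (Dec)
open import Data.Bool using (Bool; true; T; _∧_)
open import Data.Bool.Properties using (T-∧; T?)
open import Data.Empty using (⊥-elim)
open import Data.List using (length)
open import Data.List.Relation.Unary.All as All using (All; []; _∷_)
open import Data.Product using (Σ; _,_; proj₁; proj₂)
open import Data.Sum using (inj₁; inj₂)
open import Data.Unit using (tt)
import Data.Vec.Relation.Unary.All as VecAll
import Data.List.Relation.Unary.All.Properties as AllP
open import Data.Fin using (zero)
open import Function.Base using (_∘_)
open import Function.Bundles using (Equivalence)
open import Relation.Binary.PropositionalEquality using (_≢_; refl; sym; trans; cong; subst; subst₂)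
open import Relation.Nullary.Decidable using (yes; no; isYes; toWitness)
open import Data.Integer.Solver using (module +-*-Solver)
open import Data.Nat.Tactic.RingSolver using () renaming (solve-∀ to ℕ-solve-∀)
import Data.Nat.DivMod as DivMod

module Generic {c ℓ} (R : RawRing c ℓ) where
  open RawRing R

  -- Arith (+ 1) Q on coordinate pairs, with the component formulas of
  -- Defs: in ℤ it computes literally the same terms, and over polynomial
  -- syntax it feeds the ring solver.
  module Arithmetic (Q : Carrier) where
    infixl 6 _⊕_
    infixl 7 _⊗_
    infixr 8 _^τ_

    _⊕_ _⊗_ : Carrier × Carrier → Carrier × Carrier → Carrier × Carrier
    (a , b) ⊕ (c , d) = a + c , b + d
    (a , b) ⊗ (c , d) = a * c + - (Q * (b * d)) , a * d + b * c + 1# * (b * d)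

    0τ 1τ τ : Carrier × Carrier
    0τ = 0# , 0#
    1τ = 1# , 0#
    τ  = 0# , 1#

    _^τ_ : Carrier × Carrier → ℕ → Carrier × Carrier
    z ^τ ℕ.zero  = 1τ
    z ^τ ℕ.suc n = z ⊗ (z ^τ n)

    ∣_∣² : Carrier × Carrier → Carrier
    ∣ x , y ∣² = x * x + 1# * (x * y) + Q * (y * y)

    value : List (Carrier × Carrier) → Carrier × Carrier
    value []       = 0τ
    value (d ∷ ds) = d ⊕ τ ⊗ value ds

  two three : Carrier
  two   = 1# + 1#
  three = two + 1#

  quadratic : (Q K α β u v : Carrier) → Carrier
  quadratic Q K α β u v = K * Arithmetic.∣_∣² Q (u , v) + α * u + β * v

  -- The value at M e + N e′ of K ∣_∣² plus a linear form, if its values at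
  -- e, e′ are A, B, the norms of e, e′ are X, Y and Z = ∣e + e′∣² - X - Y.
  coneValue : (M N A B K X Y Z : Carrier) → Carrier
  coneValue M N A B K X Y Z =
    M * A + N * B + K * (X * (M * (M + - 1#)) + Y * (N * (N + - 1#)) + Z * (M * N))

  -- Twice the inner products of x + yτ with τ² and with τ³.
  innerτ² innerτ³ : Carrier → Carrier → Carrier → Carrier
  innerτ² Q x y = x * (1# + - (two * Q)) + Q * y
  innerτ³ Q x y = x * (1# + - (three * Q)) + Q * y * (1# + - (two * Q))

  -- K ∣e∣² + α u + β v at the six vectors e = u + vτ in ±{1, τ, τ - 1}.
  hexagonValues : Carrier → Carrier → Carrier → Carrier → List Carrier
  hexagonValues K Q α β =
    K + α ∷ K + - α ∷ K * Q + β ∷ K * Q + - β ∷ K * Q + - α + β ∷ K * Q + α + - β ∷ []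

  digitConditions : Carrier → Carrier → Carrier → List Carrier
  digitConditions Q x y =
    x * x ∷ Q * Q + - (x * x) ∷ hexagonValues (Q * Q) Q (innerτ² Q x y) (innerτ³ Q x y)

  expansionDigits : Carrier → Carrier → List (Carrier × Carrier)
  expansionDigits Q a =
    (a + - Q , 1# + - a) ∷ (1# , - 1#) ∷ (1# , 0#) ∷ (Q + - a , 0#) ∷ (1# , a + - 1#) ∷ []

  AllDigitConditions : ∀ {p} → (Carrier → Set p) → Carrier → Carrier → Set (c ⊔ p)
  AllDigitConditions P Q a =
    All (λ d → All P (digitConditions Q (proj₁ d) (proj₂ d))) (expansionDigits Q a)

  allDigitConditions? : ∀ {p} {P : Carrier → Set p} → Decidable P → ∀ Q a →
                        Dec (AllDigitConditions P Q a)
  allDigitConditions? P? Q a =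
    All.all? (λ d → All.all? P? (digitConditions Q (proj₁ d) (proj₂ d))) (expansionDigits Q a)

open Generic ℤ.+-*-rawRing
  using (quadratic; coneValue; innerτ²; innerτ³; hexagonValues; digitConditions;
         expansionDigits; AllDigitConditions)
open import Data.Integer using (_+_; _*_; -_; _<_; -[1+_]; +[1+_])

open +-*-Solver
  using (Polynomial; con; var; _:+_; _:*_; :-_; _:-_; solve; _:=_;
         HNF; ∅; _*x+_; Normal; poly; ⟦_⟧; ⟦_⟧H; ⟦_⟧N; normalise; correct)

0̂ 1̂ : ∀ {n} → Polynomial n
0̂ = con (+ 0)
1̂ = con (+ 1)

polynomialRing : ℕ → RawRing _ _
polynomialRing n = record
  { Carrier = Polynomial n ; _≈_ = _≡_ ; _+_ = _:+_ ; _*_ = _:*_ ; -_ = :-_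
  ; 0# = 0̂ ; 1# = 1̂ }

NonNeg : ℤ → Set
NonNeg i = + 0 ℤ.≤ i

+≥0 : ∀ n → NonNeg (+ n)
+≥0 n = ℤ.+≤+ ℕ.z≤n

+suc>0 : ∀ n → + 0 < + ℕ.suc n
+suc>0 n = ℤ.+<+ (ℕ.s≤s ℕ.z≤n)

nonNeg-+ : ∀ {i j} → NonNeg i → NonNeg j → NonNeg (i + j)
nonNeg-+ = ℤP.+-mono-≤

nonNeg-* : ∀ {i j} → NonNeg i → NonNeg j → NonNeg (i * j)
nonNeg-* {+ m} {+ n} _ _ = subst NonNeg (ℤP.pos-* m n) (+≥0 (m ℕ.* n))

pos-* : ∀ {i j} → + 0 < i → + 0 < j → + 0 < i * j
pos-* {+ ℕ.suc m} {+ ℕ.suc n} (ℤ.+<+ _) (ℤ.+<+ _) =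
  subst (+ 0 <_) (ℤP.pos-* (ℕ.suc m) (ℕ.suc n)) (+suc>0 (n ℕ.+ m ℕ.* ℕ.suc n))

pos-+ˡ : ∀ {i j} → + 0 < i → NonNeg j → + 0 < i + j
pos-+ˡ = ℤP.+-mono-<-≤

pos-+ʳ : ∀ {i j} → NonNeg i → + 0 < j → + 0 < i + j
pos-+ʳ = ℤP.+-mono-≤-<

i<i+j : ∀ i {j} → + 0 < j → i < i + j
i<i+j i j>0 = subst (_< i + _) (ℤP.+-identityʳ i) (ℤP.+-monoʳ-< i j>0)

0<x²⇒x≢0 : ∀ {x} → + 0 < x * x → x ≢ + 0
0<x²⇒x≢0 x²>0 refl = ℤP.<-irrefl refl x²>0

nonNeg-m[m-1] : ∀ m → NonNeg (+ m * (+ m - + 1))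
nonNeg-m[m-1] ℕ.zero    = +≥0 0
nonNeg-m[m-1] (ℕ.suc m) = nonNeg-* (+≥0 (ℕ.suc m)) (+≥0 m)

-- Positivity from the coefficients of the Horner normal form

mutual
  nonNegCoeffsᴴ : ∀ {n} → HNF (ℕ.suc n) → Bool
  nonNegCoeffsᴴ ∅         = true
  nonNegCoeffsᴴ (p *x+ c) = nonNegCoeffsᴴ p ∧ nonNegCoeffsᴺ c

  nonNegCoeffsᴺ : ∀ {n} → Normal n → Bool
  nonNegCoeffsᴺ (con c)  = isYes (+ 0 ℤ.≤? c)
  nonNegCoeffsᴺ (poly p) = nonNegCoeffsᴴ p

mutual
  ⟦⟧H-nonNeg : ∀ {n} (p : HNF (ℕ.suc n)) {ρ} → VecAll.All NonNeg ρ →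
               T (nonNegCoeffsᴴ p) → NonNeg (⟦ p ⟧H ρ)
  ⟦⟧H-nonNeg ∅         _                          _ = +≥0 0
  ⟦⟧H-nonNeg (p *x+ c) ρ≥0@(x≥0 VecAll.∷ ρ′≥0) h =
    nonNeg-+ (nonNeg-* (⟦⟧H-nonNeg p ρ≥0 (proj₁ h′)) x≥0)
             (⟦⟧N-nonNeg c ρ′≥0 (proj₂ h′))
    where h′ = Equivalence.to T-∧ h

  ⟦⟧N-nonNeg : ∀ {n} (p : Normal n) {ρ} → VecAll.All NonNeg ρ →
               T (nonNegCoeffsᴺ p) → NonNeg (⟦ p ⟧N ρ)
  ⟦⟧N-nonNeg (con c)  _   h = toWitness h
  ⟦⟧N-nonNeg (poly p) ρ≥0 h = ⟦⟧H-nonNeg p ρ≥0 h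

PositiveByCoeffs : ∀ {n} → Polynomial n → Set
PositiveByCoeffs p = T (nonNegCoeffsᴺ (normalise (p :- 1̂)))

⟦⟧-positive : ∀ {n} {p : Polynomial n} {ρ} → VecAll.All NonNeg ρ → PositiveByCoeffs p →
              + 0 < ⟦ p ⟧ ρ
⟦⟧-positive {p = p} {ρ} ρ≥0 h = ℤP.suc[i]≤j⇒i<j (ℤP.0≤i-j⇒j≤i p-1≥0)
  where
  p-1≥0 : NonNeg (⟦ p :- 1̂ ⟧ ρ)
  p-1≥0 = subst NonNeg (correct (p :- 1̂) ρ) (⟦⟧N-nonNeg (normalise (p :- 1̂)) ρ≥0 h)

-- Voronoi cell of ℤ[τ] for p = 1

coneValue-positive : ∀ m n {A B K X Y Z} → 0 ℕ.< m ℕ.+ n → + 0 < A → + 0 < B → NonNeg K →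
  NonNeg X → NonNeg Y → NonNeg Z → + 0 < coneValue (+ m) (+ n) A B K X Y Z
coneValue-positive m n {A} {B} {K} {X} {Y} {Z} m+n>0 A>0 B>0 K≥0 X≥0 Y≥0 Z≥0 =
  pos-+ˡ (linear-positive m n m+n>0) (nonNeg-* K≥0 remainder≥0)
  where
  remainder≥0 : NonNeg (X * (+ m * (+ m - + 1)) + Y * (+ n * (+ n - + 1)) + Z * (+ m * + n))
  remainder≥0 =
    nonNeg-+ (nonNeg-+ (nonNeg-* X≥0 (nonNeg-m[m-1] m)) (nonNeg-* Y≥0 (nonNeg-m[m-1] n)))
             (nonNeg-* Z≥0 (nonNeg-* (+≥0 m) (+≥0 n)))
  linear-positive : ∀ m n → 0 ℕ.< m ℕ.+ n → + 0 < + m * A + + n * B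
  linear-positive (ℕ.suc m) n         _ =
    pos-+ˡ (pos-* (+suc>0 m) A>0) (nonNeg-* (+≥0 n) (ℤP.<⇒≤ B>0))
  linear-positive ℕ.zero    (ℕ.suc n) _ = pos-+ʳ (+≥0 0) (pos-* (+suc>0 n) B>0)

module _ {Q K α β : ℤ} where
  private
    module P = Generic (polynomialRing 6)

  -- The upper half plane is covered by the cones spanned by consecutive
  -- vectors of 1, τ, τ - 1, -1.
  cone₁ : ∀ M N → quadratic Q K α β M N ≡ coneValue M N (K + α) (K * Q + β) K (+ 1) Q (+ 1)
  cone₁ = solve 6 (λ Q K α β M N →
    P.quadratic Q K α β M N := P.coneValue M N (K :+ α) (K :* Q :+ β) K 1̂ Q 1̂)
    refl Q K α β

  cone₂ : ∀ M N → quadratic Q K α β (- N) (M + N)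
                  ≡ coneValue M N (K * Q + β) (K * Q - α + β) K Q Q (Q + (Q - + 1))
  cone₂ = solve 6 (λ Q K α β M N →
    P.quadratic Q K α β (:- N) (M :+ N)
    := P.coneValue M N (K :* Q :+ β) (K :* Q :- α :+ β) K Q Q (Q :+ (Q :- 1̂)))
    refl Q K α β

  cone₃ : ∀ M N → quadratic Q K α β (- (M + N)) M
                  ≡ coneValue M N (K * Q - α + β) (K - α) K Q (+ 1) (+ 1)
  cone₃ = solve 6 (λ Q K α β M N →
    P.quadratic Q K α β (:- (M :+ N)) M
    := P.coneValue M N (K :* Q :- α :+ β) (K :- α) K Q 1̂ 1̂)
    refl Q K α β

  upper-half-positive : NonNeg K → + 0 < Q →
    + 0 < K + α → + 0 < K * Q + β → + 0 < K * Q - α + β → + 0 < K - α →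
    ∀ u j → ¬ (u ≡ + 0 × + j ≡ + 0) → + 0 < quadratic Q K α β u (+ j)
  upper-half-positive K≥0 Q>0 h₁ hτ hτ-1 h-1 (+ i) j nonzero =
    subst (+ 0 <_) (sym (cone₁ (+ i) (+ j)))
      (coneValue-positive i j (i+j>0 i j nonzero) h₁ hτ K≥0 (+≥0 1) (ℤP.<⇒≤ Q>0) (+≥0 1))
    where
    i+j>0 : ∀ i j → ¬ (+ i ≡ + 0 × + j ≡ + 0) → 0 ℕ.< i ℕ.+ j
    i+j>0 ℕ.zero    ℕ.zero    nonzero = ⊥-elim (nonzero (refl , refl))
    i+j>0 ℕ.zero    (ℕ.suc j) _       = ℕP.0<1+n
    i+j>0 (ℕ.suc i) j         _       = ℕP.0<1+n
  upper-half-positive K≥0 Q>0 h₁ hτ hτ-1 h-1 -[1+ i ] j _ with ℕ.suc i ℕ.≤? j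
  ... | yes 1+i≤j =
    let o , 1+i+o≡j = ℕP.m≤n⇒∃[o]m+o≡n 1+i≤j
        v≡ = trans (sym (ℤP.pos-+ o (ℕ.suc i)))
                   (cong +_ (trans (ℕP.+-comm o (ℕ.suc i)) 1+i+o≡j))
    in subst (λ v → + 0 < quadratic Q K α β -[1+ i ] v) v≡
         (subst (+ 0 <_) (sym (cone₂ (+ o) (+ ℕ.suc i)))
           (coneValue-positive o (ℕ.suc i) (ℕP.<-≤-trans ℕP.0<1+n (ℕP.m≤n+m (ℕ.suc i) o))
             hτ hτ-1 K≥0 Q≥0 Q≥0 (nonNeg-+ Q≥0 Q-1≥0)))
    where
    Q≥0   = ℤP.<⇒≤ Q>0
    Q-1≥0 = ℤP.i≤j⇒0≤j-i (ℤP.i<j⇒suc[i]≤j Q>0)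
  ... | no 1+i≰j =
    let o , 1+j+o≡1+i = ℕP.m≤n⇒∃[o]m+o≡n (ℕP.≰⇒> 1+i≰j)
        u≡ = cong -_ (trans (sym (ℤP.pos-+ j (ℕ.suc o)))
                            (cong +_ (trans (ℕP.+-suc j o) 1+j+o≡1+i)))
    in subst (λ u → + 0 < quadratic Q K α β u (+ j)) u≡
         (subst (+ 0 <_) (sym (cone₃ (+ j) (+ ℕ.suc o)))
           (coneValue-positive j (ℕ.suc o) (ℕP.<-≤-trans ℕP.0<1+n (ℕP.m≤n+m (ℕ.suc o) j))
             hτ-1 h-1 K≥0 (ℤP.<⇒≤ Q>0) (+≥0 1) (+≥0 1)))

-- The lower half plane is the upper one for the reflected function.
hexagon⇒positive : ∀ {Q K α β} → NonNeg K → + 0 < Q → All (+ 0 <_) (hexagonValues K Q α β) →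
  ∀ u v → ¬ (u ≡ + 0 × v ≡ + 0) → + 0 < quadratic Q K α β u v
hexagon⇒positive K≥0 Q>0 (h₁ ∷ h-1 ∷ hτ ∷ h-τ ∷ hτ-1 ∷ h1-τ ∷ []) u (+ j) nonzero =
  upper-half-positive K≥0 Q>0 h₁ hτ hτ-1 h-1 u j nonzero
hexagon⇒positive {Q} {K} {α} {β} K≥0 Q>0
  (h₁ ∷ h-1 ∷ hτ ∷ h-τ ∷ hτ-1 ∷ h1-τ ∷ []) u -[1+ j ] _ =
  subst (+ 0 <_) reflection
    (upper-half-positive {Q} {K} { - α} { - β} K≥0 Q>0 h-1 h-τ
      (subst (λ x → + 0 < K * Q + x - β) (sym (ℤP.neg-involutive α)) h1-τ)
      (subst (λ x → + 0 < K + x) (sym (ℤP.neg-involutive α)) h₁)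
      (- u) (ℕ.suc j) λ ())
  where
  reflection : quadratic Q K (- α) (- β) (- u) (+ ℕ.suc j) ≡ quadratic Q K α β u -[1+ j ]
  reflection = solve 6 (λ Q K α β u v →
    P.quadratic Q K (:- α) (:- β) (:- u) (:- v) := P.quadratic Q K α β u v)
    refl Q K α β u -[1+ j ]
    where
    module P = Generic (polynomialRing 6)

-- Minimal norm digits modulo τ² for p = 1

ℤ[τ]-≡ : ∀ {z w : ℤ[τ]} → re z ≡ re w → im z ≡ im w → z ≡ w
ℤ[τ]-≡ {mk _ _} {mk _ _} refl refl = refl

square-nonNeg : ∀ i → NonNeg (i * i)
square-nonNeg (+ n)    = nonNeg-* (+≥0 n) (+≥0 n)
square-nonNeg -[1+ n ] = +≥0 _

Q²≤[Qe]² : ∀ Q e → + 1 ℤ.≤ e * e → Q * Q ℤ.≤ (Q * e) * (Q * e)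
Q²≤[Qe]² Q e e²≥1 = begin
  Q * Q           ≡⟨ sym (ℤP.*-identityʳ (Q * Q)) ⟩
  Q * Q * + 1     ≤⟨ ℤP.*-monoˡ-≤-nonNeg (Q * Q) ⦃ Q²≥0 ⦄ e²≥1 ⟩
  Q * Q * (e * e) ≡⟨ solve 2 (λ Q e → Q :* Q :* (e :* e) := Q :* e :* (Q :* e)) refl Q e ⟩
  Q * e * (Q * e) ∎
  where
  open ℤP.≤-Reasoning
  Q²≥0 = ℤ.nonNegative (square-nonNeg Q)

multiple⇒¬0<x²<Q² : ∀ {Q x} e → x ≡ Q * e → + 0 < x * x → ¬ (+ 0 < Q * Q - x * x)
multiple⇒¬0<x²<Q² {Q} (+ 0)        refl x²>0 = ⊥-elim (0<x²⇒x≢0 x²>0 (ℤP.*-zeroʳ Q))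
multiple⇒¬0<x²<Q² {Q} e@(+[1+ _ ]) refl _    =
  ℤP.≤⇒≯ (ℤP.i≤j⇒i-j≤0 (Q²≤[Qe]² Q e (ℤ.+≤+ (ℕ.s≤s ℕ.z≤n))))
multiple⇒¬0<x²<Q² {Q} e@(-[1+ _ ]) refl _    =
  ℤP.≤⇒≯ (ℤP.i≤j⇒i-j≤0 (Q²≤[Qe]² Q e (ℤ.+≤+ (ℕ.s≤s ℕ.z≤n))))

module _ {Q : ℤ} where
  open Arith (+ 1) Q

  z≡d⊕[z⊖d] : ∀ z d → z ≡ d ⊕ (z ⊖ d)
  z≡d⊕[z⊖d] (mk a b) (mk c e) = ℤ[τ]-≡ (a≡c+[a-c] a c) (a≡c+[a-c] b e)
    where
    a≡c+[a-c] : ∀ a c → a ≡ c + (a - c)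
    a≡c+[a-c] = solve 2 (λ a c → a := c :+ (a :- c)) refl

  norm-shift : ∀ x y u v → ∣ mk x y ⊕ τ ^τ 2 ⊗ mk u v ∣²
               ≡ ∣ mk x y ∣² + quadratic Q (Q * Q) (innerτ² Q x y) (innerτ³ Q x y) u v
  norm-shift = solve 5 (λ Q x y u v → shifted-norm Q x y u v := expanded Q x y u v) refl Q
    where
    module P = Generic (polynomialRing 5)
    shifted-norm expanded : (Q x y u v : Polynomial 5) → Polynomial 5
    shifted-norm Q x y u v = S.∣ (x , y) S.⊕ S.τ S.^τ 2 S.⊗ (u , v) ∣²
      where
      module S = P.Arithmetic Q
    expanded Q x y u v =
      S.∣ (x , y) ∣² :+ P.quadratic Q (Q :* Q) (P.innerτ² Q x y) (P.innerτ³ Q x y) u v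
      where
      module S = P.Arithmetic Q

  re-τ⊗ : ∀ c e → re (τ ⊗ mk c e) ≡ Q * - e
  re-τ⊗ = solve 3 (λ Q c e → proj₁ (τ⊗ Q c e) := Q :* :- e) refl Q
    where
    τ⊗ : (Q c e : Polynomial 3) → Polynomial 3 × Polynomial 3
    τ⊗ Q c e = S.τ S.⊗ (c , e)
      where
      module S = Generic.Arithmetic (polynomialRing 3) Q

  d⊕τ²⊗0≡d : ∀ d → d ⊕ τ ^τ 2 ⊗ 0τ ≡ d
  d⊕τ²⊗0≡d (mk x y) = ℤ[τ]-≡
    (solve 3 (λ Q x y → proj₁ (shifted Q x y) := x) refl Q x y)
    (solve 3 (λ Q x y → proj₂ (shifted Q x y) := y) refl Q x y)
    where
    shifted : (Q x y : Polynomial 3) → Polynomial 3 × Polynomial 3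
    shifted Q x y = (x , y) S.⊕ S.τ S.^τ 2 S.⊗ S.0τ
      where
      module S = Generic.Arithmetic (polynomialRing 3) Q

  conditions⇒minNormDigit : ∀ {x y} → + 0 < Q → All (+ 0 <_) (digitConditions Q x y) →
                            MinNormDigit 2 (mk x y)
  conditions⇒minNormDigit {x} {y} Q>0 (x²>0 ∷ Q²-x²>0 ∷ hexagon) = inj₂ (τ∤d , minimal)
    where
    d = mk x y

    τ∤d : ¬ (τ ∣τ d)
    τ∤d (mk c e , d≡τk) =
      multiple⇒¬0<x²<Q² {Q} (- e) (trans (cong re d≡τk) (re-τ⊗ c e)) x²>0 Q²-x²>0

    minimal : ∀ z → z ≡ d mod-τ^ 2 → ¬ (z ≡ d) → ∣ d ∣² < ∣ z ∣²
    minimal z (mk u v , z-d≡τ²k) z≢d =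
      subst (∣ d ∣² <_) (sym ∣z∣²≡)
        (i<i+j ∣ d ∣² (hexagon⇒positive (square-nonNeg Q) Q>0 hexagon u v k≢0))
      where
      z≡ : z ≡ d ⊕ τ ^τ 2 ⊗ mk u v
      z≡ = trans (z≡d⊕[z⊖d] z d) (cong (d ⊕_) z-d≡τ²k)
      ∣z∣²≡ : ∣ z ∣² ≡ ∣ d ∣² + quadratic Q (Q * Q) (innerτ² Q x y) (innerτ³ Q x y) u v
      ∣z∣²≡ = trans (cong ∣_∣² z≡) (norm-shift x y u v)
      k≢0 : ¬ (u ≡ + 0 × v ≡ + 0)
      k≢0 (refl , refl) = z≢d (trans z≡ (d⊕τ²⊗0≡d d))

  nonzero-minNormDigits : ∀ a → + 0 < Q → AllDigitConditions (+ 0 <_) Q a →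
    All (λ d → MinNormDigit 2 (mk (proj₁ d) (proj₂ d)) × proj₁ d ≢ + 0) (expansionDigits Q a)
  nonzero-minNormDigits a Q>0 =
    All.map λ {d} c → conditions⇒minNormDigit {proj₁ d} {proj₂ d} Q>0 c , 0<x²⇒x≢0 (All.head c)

module Weight (p q : ℤ) where
  open Arith p q

  weight-≤-length : ∀ ds → weight ds ℕ.≤ length ds
  weight-≤-length []       = ℕ.z≤n
  weight-≤-length (d ∷ ds) with re d ℤ.≟ + 0 | im d ℤ.≟ + 0
  ... | yes _ | yes _ = ℕP.m≤n⇒m≤1+n (weight-≤-length ds)
  ... | yes _ | no _  = ℕ.s≤s (weight-≤-length ds)
  ... | no _  | _     = ℕ.s≤s (weight-≤-length ds)

  weight-∷ : ∀ d ds → re d ≢ + 0 → weight (d ∷ ds) ≡ ℕ.suc (weight ds)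
  weight-∷ d ds re≢0 with re d ℤ.≟ + 0 | im d ℤ.≟ + 0
  ... | yes re≡0 | _ = ⊥-elim (re≢0 re≡0)
  ... | no _     | _ = refl

  lighter-expansion⇒¬NAFMinimal : ∀ {w} ds es → ValidExpansion w ds → IsNAF w ds →
    ValidExpansion w es → value es ≡ value ds → weight es ℕ.< weight ds → ¬ NAFMinimal w
  lighter-expansion⇒¬NAFMinimal ds es valid-ds naf valid-es same lighter minimal =
    ℕP.<⇒≱ lighter (minimal ds valid-ds naf es valid-es same)

module Expansions (Q a : ℤ) where
  open Arith (+ 1) Q
  open Weight (+ 1) Q

  A B E F G : ℤ[τ]
  A = mk (a - Q) (+ 1 - a)
  B = mk (+ 1) (- + 1)
  E = 1τ
  F = mk (Q - a) (+ 0)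
  G = mk (+ 1) (a - + 1)

  expansion-identity : A ⊗ τ ⊕ B ≡ E ⊗ τ ^τ 4 ⊕ F ⊗ τ ^τ 2 ⊕ G
  expansion-identity = ℤ[τ]-≡
    (solve 2 (λ Q a → proj₁ (lhs Q a) := proj₁ (rhs Q a)) refl Q a)
    (solve 2 (λ Q a → proj₂ (lhs Q a) := proj₂ (rhs Q a)) refl Q a)
    where
    lhs rhs : Polynomial 2 → Polynomial 2 → Polynomial 2 × Polynomial 2
    lhs Q a = (a :- Q , 1̂ :- a) S.⊗ S.τ S.⊕ (1̂ , :- 1̂)
      where
      module S = Generic.Arithmetic (polynomialRing 2) Q
    rhs Q a = S.1τ S.⊗ S.τ S.^τ 4 S.⊕ (Q :- a , 0̂) S.⊗ S.τ S.^τ 2 S.⊕ (1̂ , a :- 1̂)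
      where
      module S = Generic.Arithmetic (polynomialRing 2) Q

  value-identity : value (B ∷ A ∷ []) ≡ value (G ∷ 0τ ∷ F ∷ 0τ ∷ E ∷ [])
  value-identity = ℤ[τ]-≡
    (solve 2 (λ Q a → proj₁ (lhs Q a) := proj₁ (rhs Q a)) refl Q a)
    (solve 2 (λ Q a → proj₂ (lhs Q a) := proj₂ (rhs Q a)) refl Q a)
    where
    lhs rhs : Polynomial 2 → Polynomial 2 → Polynomial 2 × Polynomial 2
    lhs Q a = S.value ((1̂ , :- 1̂) ∷ (a :- Q , 1̂ :- a) ∷ [])
      where
      module S = Generic.Arithmetic (polynomialRing 2) Q
    rhs Q a = S.value ((1̂ , a :- 1̂) ∷ S.0τ ∷ (Q :- a , 0̂) ∷ S.0τ ∷ S.1τ ∷ [])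
      where
      module S = Generic.Arithmetic (polynomialRing 2) Q

  naf : IsNAF 2 (G ∷ 0τ ∷ F ∷ 0τ ∷ E ∷ [])
  naf = inj₂ (refl , tt) , inj₁ refl , inj₂ (refl , tt) , inj₁ refl , inj₂ tt , tt

  naf-heavier : Q - a ≢ + 0 → weight (B ∷ A ∷ []) ℕ.< weight (G ∷ 0τ ∷ F ∷ 0τ ∷ E ∷ [])
  naf-heavier F≢0 =
    ℕP.≤-<-trans (weight-≤-length (B ∷ A ∷ [])) (ℕP.≤-reflexive (sym weight≡3))
    where
    weight≡3 : weight (G ∷ 0τ ∷ F ∷ 0τ ∷ E ∷ []) ≡ 3
    weight≡3 = trans (weight-∷ G (0τ ∷ F ∷ 0τ ∷ E ∷ []) λ ())
                     (cong ℕ.suc (weight-∷ F (0τ ∷ E ∷ []) F≢0))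

-- The digit conditions for every q ≥ 3

module Symbolic = Generic (polynomialRing 1)

-- q = 3 + r + 2t and ⌈q/2⌉ = 2 + t, as polynomials in t.
q̂ : ℕ → Polynomial 1
q̂ r = con (+ (3 ℕ.+ r)) :+ con (+ 2) :* var zero

â : Polynomial 1
â = con (+ 2) :+ var zero

digitConditions-byCoeffs : ∀ r → r ℕ.≤ 1 → Symbolic.AllDigitConditions PositiveByCoeffs (q̂ r) â
digitConditions-byCoeffs 0 _ = toWitness {a? = Symbolic.allDigitConditions? (T? ∘ _) (q̂ 0) â} tt
digitConditions-byCoeffs 1 _ = toWitness {a? = Symbolic.allDigitConditions? (T? ∘ _) (q̂ 1) â} tt
digitConditions-byCoeffs (ℕ.suc (ℕ.suc _)) (ℕ.s≤s ())

⟦⟧-AllDigitConditions : ∀ Q a {ρ} → VecAll.All NonNeg ρ →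
  Symbolic.AllDigitConditions PositiveByCoeffs Q a → AllDigitConditions (+ 0 <_) (⟦ Q ⟧ ρ) (⟦ a ⟧ ρ)
⟦⟧-AllDigitConditions Q a {ρ} ρ≥0 =
  AllP.map⁺ {f = λ d → ⟦ proj₁ d ⟧ ρ , ⟦ proj₂ d ⟧ ρ}
    ∘ All.map (AllP.map⁺ {f = λ p → ⟦ p ⟧ ρ} ∘ All.map λ {p} → ⟦⟧-positive {p = p} ρ≥0)

⌈q/2⌉-split : ∀ q → 3 ℕ.≤ q →
  Σ ℕ λ r → Σ ℕ λ t → r ℕ.≤ 1 × q ≡ 3 ℕ.+ r ℕ.+ 2 ℕ.* t × (q ℕ.+ 1) / 2 ≡ 2 ℕ.+ t
⌈q/2⌉-split q 3≤q =
  let k , 3+k≡q = ℕP.m≤n⇒∃[o]m+o≡n 3≤q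
      r , t , r≤1 , 3+k≡ , half = split k
  in r , t , r≤1 , trans (sym 3+k≡q) 3+k≡ ,
     trans (cong (_/ 2) (trans (cong (ℕ._+ 1) (sym 3+k≡q)) (ℕP.+-comm (3 ℕ.+ k) 1))) half
  where
  split : ∀ k → Σ ℕ λ r → Σ ℕ λ t →
          r ℕ.≤ 1 × 3 ℕ.+ k ≡ 3 ℕ.+ r ℕ.+ 2 ℕ.* t × (4 ℕ.+ k) / 2 ≡ 2 ℕ.+ t
  split 0 = 0 , 0 , ℕ.z≤n , refl , refl
  split 1 = 1 , 0 , ℕ.s≤s ℕ.z≤n , refl , refl
  split (ℕ.suc (ℕ.suc k)) =
    let r , t , r≤1 , 3+k≡ , half = split k
    in r , ℕ.suc t , r≤1 , trans (cong (2 ℕ.+_) 3+k≡) (step r t) ,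
       trans (DivMod.m/n≡1+[m∸n]/n {6 ℕ.+ k} {2} (ℕ.s≤s (ℕ.s≤s ℕ.z≤n))) (cong ℕ.suc half)
    where
    step : ∀ r t → 2 ℕ.+ (3 ℕ.+ r ℕ.+ 2 ℕ.* t) ≡ 3 ℕ.+ r ℕ.+ 2 ℕ.* ℕ.suc t
    step = ℕ-solve-∀

digitConditions-hold : ∀ q → 3 ℕ.≤ q → AllDigitConditions (+ 0 <_) (+ q) (+ ((q ℕ.+ 1) / 2))
digitConditions-hold q 3≤q =
  let r , t , r≤1 , q≡ , a≡ = ⌈q/2⌉-split q 3≤q
      Q≡ = trans (cong +_ q≡)
                 (trans (ℤP.pos-+ (3 ℕ.+ r) (2 ℕ.* t)) (cong (_+_ (+ (3 ℕ.+ r))) (ℤP.pos-* 2 t)))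
      a≡′ = trans (cong +_ a≡) (ℤP.pos-+ 2 t)
  in subst₂ (AllDigitConditions (+ 0 <_)) (sym Q≡) (sym a≡′)
       (⟦⟧-AllDigitConditions (q̂ r) â (+≥0 t VecAll.∷ VecAll.[])
         (digitConditions-byCoeffs r r≤1))

proposition13p1 : (q : ℕ) → 3 ≤ q →
    let open Arith (+ 1) (+ q)
        a = (q Data.Nat.+ 1) / 2
        E = 1τ
        A = mk ((+ a) - (+ q)) ((+ 1) - (+ a))
        F = mk ((+ q) - (+ a)) (+ 0)
        B = mk (+ 1) (Data.Integer.- (+ 1))
        G = mk (+ 1) ((+ a) - (+ 1))
    in (A ⊗ τ ⊕ B ≡ E ⊗ τ ^τ 4 ⊕ F ⊗ τ ^τ 2 ⊕ G)
       × MinNormDigit 2 A × MinNormDigit 2 B × MinNormDigit 2 E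
       × MinNormDigit 2 F × MinNormDigit 2 G
       × ValidExpansion 2 (B ∷ A ∷ [])
       × ValidExpansion 2 (G ∷ 0τ ∷ F ∷ 0τ ∷ E ∷ [])
       × value (B ∷ A ∷ []) ≡ value (G ∷ 0τ ∷ F ∷ 0τ ∷ E ∷ [])
       × IsNAF 2 (G ∷ 0τ ∷ F ∷ 0τ ∷ E ∷ [])
       × ¬ NAFMinimal 2
proposition13p1 q 3≤q
  with nonzero-minNormDigits (+ ((q ℕ.+ 1) / 2)) (ℤ.+<+ (ℕP.<-≤-trans ℕP.0<1+n 3≤q))
         (digitConditions-hold q 3≤q)
... | (mA , _) ∷ (mB , _) ∷ (mE , _) ∷ (mF , F≢0) ∷ (mG , _) ∷ [] =
    expansion-identity , mA , mB , mE , mF , mG , valid-BA , valid-NAF , value-identity , naf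
  , lighter-expansion⇒¬NAFMinimal _ _ valid-NAF naf valid-BA value-identity (naf-heavier F≢0)
  where
  open Expansions (+ q) (+ ((q ℕ.+ 1) / 2))
  open Weight (+ 1) (+ q)
  valid-BA  = mB ∷ mA ∷ []
  valid-NAF = mG ∷ inj₁ refl ∷ mF ∷ inj₁ refl ∷ mE ∷ []
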